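{- For every 2-SAT formula $F$, \[ S(F)=\{x : x\underset{D_F}{\rightsquigarrow}\overline x\}. \]
   Context: Variables $x_1,\dots,x_n$, literals $x_i,\overline x_i$ (with $\overline{\overline x}=x$). A 2-clause is $u\vee v$ with $u,v$ strictly distinct ($u\ne v$, $u\ne \overline v$); a 2-SAT formula is a conjunction of 2-clauses; a subformula is obtained by deleting clauses. For a literal $x$, $H\wedge x$ denotes $H$ with the unit clause $x$ added. The spine is $S(F)=\{x:\exists H\subset F, H\text{ satisfiable}, H\wedge x\text{ unsatisfiable}\}$. The digraph $D_F$ has the $2n$ literals as vertices and an edge $x\to y$ iff $\overline x\vee y$ is a clause of $F$ (so each clause $u\vee v$ gives edges $\overline u\to v$ and $\overline v\to u$). $x\underset{D_F}{\rightsquigarrow} y$ means $D_F$ contains a directed path from $x$ to $y$ (by convention $x\rightsquigarrow x$). -}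

module Defs where

open import Data.Nat using (ℕ)
open import Data.Fin using (Fin)
open import Data.Bool using (Bool; true; false; not; _∨_)
open import Data.Product using (Σ; ∃; _×_; _,_; proj₁; proj₂)
open import Data.Sum using (_⊎_)
open import Data.List using (List)
open import Data.List.Membership.Propositional using (_∈_)
open import Data.List.Relation.Binary.Sublist.Propositional using (_⊆_)
open import Data.List.Relation.Unary.All using (All)
open import Relation.Binary.PropositionalEquality using (_≡_; _≢_)
open import Relation.Binary.Construct.Closure.ReflexiveTransitive using (Star)
open import Relation.Nullary using (¬_)

-- A literal over variables x_1..x_n: a variable index and a polarity
-- (true = positive literal x_i, false = negated literal x̄_i).
Literal : ℕ → Set
Literal n = Fin n × Bool

neg : ∀ {n} → Literal n → Literal n
neg (i , b) = i , not b

record Clause (n : ℕ) : Set where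
  constructor clause
  field
    lit₁ : Literal n
    lit₂ : Literal n
    distinct : lit₁ ≢ lit₂
    notCompl : lit₁ ≢ neg lit₂
open Clause public

Formula : ℕ → Set
Formula n = List (Clause n)

_⊑_ : ∀ {n} → Formula n → Formula n → Set
H ⊑ F = H ⊆ F

Assignment : ℕ → Set
Assignment n = Fin n → Bool

val : ∀ {n} → Assignment n → Literal n → Bool
val a (i , true) = a i
val a (i , false) = not (a i)

satClause : ∀ {n} → Assignment n → Clause n → Set
satClause a c = (val a (lit₁ c) ∨ val a (lit₂ c)) ≡ true

satFormula : ∀ {n} → Assignment n → Formula n → Set
satFormula a F = All (satClause a) F

Satisfiable : ∀ {n} → Formula n → Set
Satisfiable {n} F = Σ (Assignment n) λ a → satFormula a F

SatisfiableWith : ∀ {n} → Formula n → Literal n → Set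
SatisfiableWith {n} F x = Σ (Assignment n) λ a → satFormula a F × val a x ≡ true

InSpine : ∀ {n} → Formula n → Literal n → Set
InSpine F x = Σ _ λ H → H ⊑ F × Satisfiable H × ¬ SatisfiableWith H x

-- edge x → y in D_F iff  x̄ ∨ y  is a clause of F (clauses are unordered)
Edge : ∀ {n} → Formula n → Literal n → Literal n → Set
Edge F x y = Σ _ λ c → c ∈ F ×
  ((lit₁ c ≡ neg x × lit₂ c ≡ y) ⊎ (lit₂ c ≡ neg x × lit₁ c ≡ y))

_⇝[_]_ : ∀ {n} → Literal n → Formula n → Literal n → Set
x ⇝[ F ] y = Star (Edge F) x y

{-# OPTIONS --safe #-}
-- If b satisfies H but x does not reach neg x in D_H, then b, overridden so that every literal
-- reachable from x is true, still satisfies H and also x; so H ∧ x unsatisfiable forces x ⇝ neg x.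
-- Conversely, take a shortest walk from x to neg x, of length k + 1, and make every literal within
-- ⌊k/2⌋ steps of neg x true; by minimality of k this is consistent. Each edge of the walk then has a
-- false tail (first half) or a true head (second half), so the walk survives in the subformula H of
-- clauses satisfied by this assignment: H is satisfiable, but H ∧ x is not.
module Submission where

open import Defs
open import Data.Nat using (ℕ; zero; suc; _+_; _≤_; _<_; _≤?_; ⌊_/2⌋; ⌈_/2⌉; z≤n; s≤s)
open import Data.Nat.Properties
  using (≤-refl; ≤-trans; ≤-reflexive; ≤-pred; n≤1+n; +-suc; +-monoʳ-≤; +-monoˡ-≤; +-cancelˡ-≤;
         <⇒≱; ≰⇒>; ⌊n/2⌋-mono; ⌊n/2⌋≤⌈n/2⌉; ⌊n/2⌋+⌈n/2⌉≡n)
import Data.Fin as Fin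
open import Data.Bool as Bool using (true; false; not; _∨_)
open import Data.Bool.Properties using (not-involutive; not-¬; ∨-comm; ∨-zeroʳ)
open import Data.Product using (∃; _×_; _,_; proj₁; proj₂)
open import Data.Product.Properties using (≡-dec; ×-≡,≡→≡)
open import Data.Sum using (_⊎_; inj₁; inj₂)
open import Data.List using (List; []; _∷_; filter)
open import Data.List.Relation.Unary.Any using (Any; here; there; any?)
import Data.List.Relation.Unary.All as All
open import Data.List.Relation.Unary.All.Properties using (all-filter)
open import Data.List.Membership.Propositional using (_∈_; find; lose)
open import Data.List.Membership.Propositional.Properties using (∈-filter⁺)
open import Data.List.Relation.Binary.Sublist.Propositional.Properties using (filter-⊆; Any-resp-⊆)
open import Function using (_∘_)
open import Function.Bundles using (_⇔_; mk⇔; Equivalence)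
open import Relation.Binary.Definitions using (Decidable; DecidableEquality)
open import Relation.Binary.PropositionalEquality
open import Relation.Binary.Construct.Closure.ReflexiveTransitive as Star using (Star; ε; _◅_; _◅◅_)
open import Relation.Nullary using (¬_; Dec; yes; no; contradiction)
open import Relation.Nullary.Decidable using (map′; _×-dec_; _⊎-dec_)

⌊n/2⌋+⌊n/2⌋≤n : ∀ n → ⌊ n /2⌋ + ⌊ n /2⌋ ≤ n
⌊n/2⌋+⌊n/2⌋≤n n = ≤-trans (+-monoʳ-≤ ⌊ n /2⌋ (⌊n/2⌋≤⌈n/2⌉ n)) (≤-reflexive (⌊n/2⌋+⌈n/2⌉≡n n))

n≤1+⌊n/2⌋+⌊n/2⌋ : ∀ n → n ≤ suc (⌊ n /2⌋ + ⌊ n /2⌋)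
n≤1+⌊n/2⌋+⌊n/2⌋ n = begin
  n                        ≡⟨ ⌊n/2⌋+⌈n/2⌉≡n n ⟨
  ⌊ n /2⌋ + ⌈ n /2⌉        ≤⟨ +-monoʳ-≤ ⌊ n /2⌋ (⌊n/2⌋-mono (n≤1+n (suc n))) ⟩
  ⌊ n /2⌋ + suc ⌊ n /2⌋    ≡⟨ +-suc ⌊ n /2⌋ ⌊ n /2⌋ ⟩
  suc (⌊ n /2⌋ + ⌊ n /2⌋)  ∎
  where open Data.Nat.Properties.≤-Reasoning

least : {P : ℕ → Set} → (∀ m → Dec (P m)) → (∀ {i j} → i ≤ j → P i → P j) →
        ∀ {m} → P m → ∃ λ k → P k × (∀ {j} → P j → k ≤ j)
least P? mono {zero} p = zero , p , λ _ → z≤n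
least P? mono {suc m} p with P? m
... | yes q = least P? mono q
... | no ¬q = suc m , p , λ pj → ≰⇒> (λ j≤m → ¬q (mono j≤m pj))

data Walk≤ {A : Set} (R : A → A → Set) : ℕ → A → A → Set where
  stay : ∀ {m x} → Walk≤ R m x x
  step : ∀ {m x y z} → R x y → Walk≤ R m y z → Walk≤ R (suc m) x z

module _ {A : Set} {R : A → A → Set} where

  Walk≤-zero : ∀ {x y} → Walk≤ R 0 x y → x ≡ y
  Walk≤-zero stay = refl

  Walk≤-weaken : ∀ {i j x y} → i ≤ j → Walk≤ R i x y → Walk≤ R j x y
  Walk≤-weaken _         stay       = stay
  Walk≤-weaken (s≤s i≤j) (step e w) = step e (Walk≤-weaken i≤j w)

  _++_ : ∀ {i j x y z} → Walk≤ R i x y → Walk≤ R j y z → Walk≤ R (i + j) x z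
  stay     ++ w = Walk≤-weaken (+-monoˡ-≤ _ z≤n) w
  step e v ++ w = step e (v ++ w)

  _▷_ : ∀ {m x y z} → Walk≤ R m x y → R y z → Walk≤ R (suc m) x z
  stay     ▷ e = step e stay
  step d w ▷ e = step d (w ▷ e)

  Walk≤-reverse : (f : A → A) → (∀ {x y} → R x y → R (f y) (f x)) →
                  ∀ {m x y} → Walk≤ R m x y → Walk≤ R m (f y) (f x)
  Walk≤-reverse f rev stay       = stay
  Walk≤-reverse f rev (step e w) = Walk≤-reverse f rev w ▷ rev e

  Star⇒Walk≤ : ∀ {x y} → Star R x y → ∃ λ m → Walk≤ R m x y
  Star⇒Walk≤ ε       = 0 , stay
  Star⇒Walk≤ (e ◅ p) = let m , w = Star⇒Walk≤ p in suc m , step e w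

module _ {A : Set} (_≟_ : DecidableEquality A) where

  Arc : List (A × A) → A → A → Set
  Arc es x y = (x , y) ∈ es

  Star-Arc-∷⁻ : ∀ {a b es x y} → Star (Arc ((a , b) ∷ es)) x y →
                Star (Arc es) x y ⊎ (Star (Arc es) x a × Star (Arc es) b y)
  Star-Arc-∷⁻ ε = inj₁ ε
  Star-Arc-∷⁻ (here refl ◅ p) with Star-Arc-∷⁻ p
  ... | inj₁ q       = inj₂ (ε , q)
  ... | inj₂ (_ , q) = inj₂ (ε , q)
  Star-Arc-∷⁻ (there e ◅ p) with Star-Arc-∷⁻ p
  ... | inj₁ q        = inj₁ (e ◅ q)
  ... | inj₂ (q , q′) = inj₂ (e ◅ q , q′)

  Star-Arc-∷⁺ : ∀ {a b es x y} → Star (Arc es) x y ⊎ (Star (Arc es) x a × Star (Arc es) b y) →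
                Star (Arc ((a , b) ∷ es)) x y
  Star-Arc-∷⁺ (inj₁ q)        = Star.map there q
  Star-Arc-∷⁺ (inj₂ (q , q′)) = Star.map there q ◅◅ here refl ◅ Star.map there q′

  Star-Arc-dec : ∀ es → Decidable (Star (Arc es))
  Star-Arc-dec [] x y = map′ (λ { refl → ε }) (λ { ε → refl ; (() ◅ _) }) (x ≟ y)
  Star-Arc-dec ((a , b) ∷ es) x y = map′ Star-Arc-∷⁺ Star-Arc-∷⁻
    (Star-Arc-dec es x y ⊎-dec (Star-Arc-dec es x a ×-dec Star-Arc-dec es b y))

  module _ {R : A → A → Set} (es : List (A × A)) (R⇔Arc : ∀ {x y} → R x y ⇔ Arc es x y) where
    open Equivalence

    Star-dec : Decidable (Star R)
    Star-dec x y = map′ (Star.map (from R⇔Arc)) (Star.map (to R⇔Arc)) (Star-Arc-dec es x y)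

    Walk≤-dec : ∀ m → Decidable (Walk≤ R m)
    Walk≤-dec zero x z = map′ (λ { refl → stay }) Walk≤-zero (x ≟ z)
    Walk≤-dec (suc m) x z = map′ join split
      ((x ≟ z) ⊎-dec any? (λ e → (x ≟ proj₁ e) ×-dec Walk≤-dec m (proj₂ e) z) es)
      where
      FirstArc : A × A → Set
      FirstArc e = x ≡ proj₁ e × Walk≤ R m (proj₂ e) z
      join : x ≡ z ⊎ Any FirstArc es → Walk≤ R (suc m) x z
      join (inj₁ refl) = stay
      join (inj₂ e∈)   with find e∈
      ... | _ , e∈es , refl , w = step (from R⇔Arc e∈es) w
      split : Walk≤ R (suc m) x z → x ≡ z ⊎ Any FirstArc es
      split stay       = inj₁ refl
      split (step e w) = inj₂ (lose (to R⇔Arc e) (refl , w))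

_≟ₗ_ : ∀ {n} → DecidableEquality (Literal n)
_≟ₗ_ = ≡-dec Fin._≟_ Bool._≟_

neg-involutive : ∀ {n} (l : Literal n) → neg (neg l) ≡ l
neg-involutive (i , b) = cong (i ,_) (not-involutive b)

neg-flip : ∀ {n} {u x : Literal n} → u ≡ neg x → x ≡ neg u
neg-flip {x = x} refl = sym (neg-involutive x)

l≢neg-l : ∀ {n} {l : Literal n} → l ≢ neg l
l≢neg-l = not-¬ refl ∘ cong proj₂

val-neg : ∀ {n} (a : Assignment n) l → val a (neg l) ≡ not (val a l)
val-neg a (i , true)  = refl
val-neg a (i , false) = sym (not-involutive (a i))

∨-trueˡ : ∀ {b c} → b ≡ true → b ∨ c ≡ true
∨-trueˡ refl = refl

∨-trueʳ : ∀ {b c} → c ≡ true → b ∨ c ≡ true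
∨-trueʳ {b} refl = ∨-zeroʳ b

satClause? : ∀ {n} (a : Assignment n) (c : Clause n) → Dec (satClause a c)
satClause? a c = (val a (lit₁ c) ∨ val a (lit₂ c)) Bool.≟ true

module _ {n} {F : Formula n} where

  clause-edge₁ : ∀ {c} → c ∈ F → Edge F (neg (lit₁ c)) (lit₂ c)
  clause-edge₁ c∈ = _ , c∈ , inj₁ (sym (neg-involutive _) , refl)

  clause-edge₂ : ∀ {c} → c ∈ F → Edge F (neg (lit₂ c)) (lit₁ c)
  clause-edge₂ c∈ = _ , c∈ , inj₂ (sym (neg-involutive _) , refl)

  Edge-contrapose : ∀ {x y} → Edge F x y → Edge F (neg y) (neg x)
  Edge-contrapose (c , c∈ , inj₁ (p , q)) = c , c∈ , inj₂ (trans q (sym (neg-involutive _)) , p)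
  Edge-contrapose (c , c∈ , inj₂ (p , q)) = c , c∈ , inj₁ (trans q (sym (neg-involutive _)) , p)

  Edge-clause-value : ∀ (a : Assignment n) {x y} (e : Edge F x y) →
                      val a (lit₁ (proj₁ e)) ∨ val a (lit₂ (proj₁ e)) ≡ val a (neg x) ∨ val a y
  Edge-clause-value a (c , _ , inj₁ (p , q)) = cong₂ _∨_ (cong (val a) p) (cong (val a) q)
  Edge-clause-value a (c , _ , inj₂ (p , q)) =
    trans (∨-comm (val a (lit₁ c)) (val a (lit₂ c))) (cong₂ _∨_ (cong (val a) p) (cong (val a) q))

  Edge-preserves-truth : ∀ {a x y} → satFormula a F → Edge F x y → val a x ≡ true → val a y ≡ true
  Edge-preserves-truth {a} {x} {y} sat e ax = begin
    val a y                      ≡⟨⟩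
    false ∨ val a y              ≡⟨ cong (_∨ val a y) (trans (val-neg a x) (cong not ax)) ⟨
    val a (neg x) ∨ val a y      ≡⟨ Edge-clause-value a e ⟨
    val a (lit₁ (proj₁ e)) ∨ val a (lit₂ (proj₁ e)) ≡⟨ All.lookup sat (proj₁ (proj₂ e)) ⟩
    true                         ∎
    where open ≡-Reasoning

  Edge-map : ∀ {G : Formula n} {x y} → (∀ {c} → c ∈ F → c ∈ G) → Edge F x y → Edge G x y
  Edge-map f (c , c∈ , s) = c , f c∈ , s

  Edge-filter : ∀ {P : Clause n → Set} (P? : ∀ c → Dec (P c)) {x y} (e : Edge F x y) →
                P (proj₁ e) → Edge (filter P? F) x y
  Edge-filter P? (c , c∈ , s) pc = c , ∈-filter⁺ P? c∈ pc , s

  ⇝-contrapose : ∀ {x y} → x ⇝[ F ] y → neg y ⇝[ F ] neg x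
  ⇝-contrapose ε       = ε
  ⇝-contrapose (e ◅ p) = ⇝-contrapose p ◅◅ Star.return (Edge-contrapose e)

  ⇝-contrapose′ : ∀ {x y} → x ⇝[ F ] neg y → y ⇝[ F ] neg x
  ⇝-contrapose′ {x} {y} p = subst (_⇝[ F ] neg x) (neg-involutive y) (⇝-contrapose p)

  Walk≤-contrapose′ : ∀ {m x y} → Walk≤ (Edge F) m x (neg y) → Walk≤ (Edge F) m y (neg x)
  Walk≤-contrapose′ {m} {x} {y} w =
    subst (λ z → Walk≤ (Edge F) m z (neg x)) (neg-involutive y) (Walk≤-reverse neg Edge-contrapose w)

  ⇝-preserves-truth : ∀ {a x y} → satFormula a F → x ⇝[ F ] y → val a x ≡ true → val a y ≡ true
  ⇝-preserves-truth sat ε       ax = ax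
  ⇝-preserves-truth sat (e ◅ p) ax = ⇝-preserves-truth sat p (Edge-preserves-truth sat e ax)

  ⇝neg⇒¬SatisfiableWith : ∀ {x} → x ⇝[ F ] neg x → ¬ SatisfiableWith F x
  ⇝neg⇒¬SatisfiableWith {x} p (a , sat , ax) =
    not-¬ (sym ax) (trans (sym (⇝-preserves-truth sat p ax)) (val-neg a x))

arcs : ∀ {n} → Formula n → List (Literal n × Literal n)
arcs []      = []
arcs (c ∷ F) = (neg (lit₁ c) , lit₂ c) ∷ (neg (lit₂ c) , lit₁ c) ∷ arcs F

Edge⇔Arc : ∀ {n} {F : Formula n} {x y} → Edge F x y ⇔ Arc _≟ₗ_ (arcs F) x y
Edge⇔Arc = mk⇔ to from
  where
  to : ∀ {F x y} → Edge F x y → (x , y) ∈ arcs F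
  to (_ , here refl , inj₁ (p , q)) = here (×-≡,≡→≡ (neg-flip p , sym q))
  to (_ , here refl , inj₂ (p , q)) = there (here (×-≡,≡→≡ (neg-flip p , sym q)))
  to (c , there c∈ , s)             = there (there (to (c , c∈ , s)))
  from : ∀ {F x y} → (x , y) ∈ arcs F → Edge F x y
  from {_ ∷ _} (here refl)         = clause-edge₁ (here refl)
  from {_ ∷ _} (there (here refl)) = clause-edge₂ (here refl)
  from {_ ∷ _} (there (there a))   = Edge-map there (from a)

⇝-dec : ∀ {n} (F : Formula n) → Decidable (_⇝[ F ]_)
⇝-dec F = Star-dec _≟ₗ_ (arcs F) Edge⇔Arc

Walk≤-Edge-dec : ∀ {n} (F : Formula n) m → Decidable (Walk≤ (Edge F) m)
Walk≤-Edge-dec F = Walk≤-dec _≟ₗ_ (arcs F) Edge⇔Arc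

Consistent : ∀ {n} → (Literal n → Set) → Set
Consistent P = ∀ {l} → P l → ¬ P (neg l)

Closed : ∀ {n} → Formula n → (Literal n → Set) → Set
Closed F P = ∀ {l l′} → Edge F l l′ → P l → P l′

module _ {n} {P : Literal n → Set} (P? : ∀ l → Dec (P l)) where

  override : Assignment n → Assignment n
  override b i with P? (i , true) | P? (i , false)
  ... | yes _ | _     = true
  ... | no _  | yes _ = false
  ... | no _  | no _  = b i

  override-true : Consistent P → ∀ {b l} → P l → val (override b) l ≡ true
  override-true cons {l = i , true} p with P? (i , true) | P? (i , false)
  ... | yes _ | _ = refl
  ... | no ¬p | _ = contradiction p ¬p
  override-true cons {l = i , false} p with P? (i , true) | P? (i , false)
  ... | yes q | _     = contradiction p (cons q)
  ... | no _  | yes _ = refl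
  ... | no _  | no ¬p = contradiction p ¬p

  override-same : ∀ {b l} → ¬ P l → ¬ P (neg l) → val (override b) l ≡ val b l
  override-same {l = i , true} ¬p ¬q with P? (i , true) | P? (i , false)
  ... | yes p | _     = contradiction p ¬p
  ... | no _  | yes q = contradiction q ¬q
  ... | no _  | no _  = refl
  override-same {l = i , false} ¬p ¬q with P? (i , true) | P? (i , false)
  ... | yes q | _     = contradiction q ¬q
  ... | no _  | yes p = contradiction p ¬p
  ... | no _  | no _  = refl

  override-satisfies : ∀ {F b} → Consistent P → Closed F P → satFormula b F → satFormula (override b) F
  override-satisfies {F} {b} cons closed sat =
    All.tabulate λ c∈ → clause-satisfied c∈ (All.lookup sat c∈)
    where
    clause-satisfied : ∀ {c} → c ∈ F → satClause b c → satClause (override b) c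
    clause-satisfied {c} c∈ s with P? (lit₁ c) | P? (lit₂ c)
    ... | yes p  | _      = ∨-trueˡ (override-true cons p)
    ... | no _   | yes p  = ∨-trueʳ (override-true cons p)
    ... | no ¬p₁ | no ¬p₂ = trans (cong₂ _∨_ same₁ same₂) s
      where
      same₁ = override-same ¬p₁ (¬p₂ ∘ closed (clause-edge₁ c∈))
      same₂ = override-same ¬p₂ (¬p₁ ∘ closed (clause-edge₂ c∈))

satisfiableWith : ∀ {n} {H : Formula n} {x} → Satisfiable H → ¬ (x ⇝[ H ] neg x) → SatisfiableWith H x
satisfiableWith {H = H} {x} (b , sat) ¬p =
  override P? b , override-satisfies P? consistent closed sat , override-true P? consistent ε
  where
  P? = ⇝-dec H x
  consistent : Consistent (x ⇝[ H ]_)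
  consistent p q = ¬p (p ◅◅ ⇝-contrapose′ q)
  closed : Closed H (x ⇝[ H ]_)
  closed e p = p ◅◅ Star.return e

spine⇒⇝ : ∀ {n} {F : Formula n} {x} → InSpine F x → x ⇝[ F ] neg x
spine⇒⇝ (H , H⊑F , sat , unsat) with ⇝-dec H _ _
... | yes p = Star.map (Edge-map (Any-resp-⊆ H⊑F)) p
... | no ¬p = contradiction (satisfiableWith sat ¬p) unsat

module Shortest {n} {F : Formula n} {x : Literal n} {k : ℕ}
  (shortest : Walk≤ (Edge F) (suc k) x (neg x))
  (minimal : ∀ {m} → Walk≤ (Edge F) m x (neg x) → suc k ≤ m) where

  r : ℕ
  r = ⌊ k /2⌋

  Near : Literal n → Set
  Near l = Walk≤ (Edge F) r l (neg x)

  near-consistent : Consistent Near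
  near-consistent p q = <⇒≱ (s≤s (⌊n/2⌋+⌊n/2⌋≤n k)) (minimal (Walk≤-contrapose′ p ++ q))

  near? : ∀ l → Dec (Near l)
  near? l = Walk≤-Edge-dec F r l (neg x)

  a : Assignment n
  a = override near? (λ _ → true)

  near-true : ∀ {l} → Near l → val a l ≡ true
  near-true = override-true near? near-consistent

  H : Formula n
  H = filter (satClause? a) F

  rest≤r : ∀ {i j} → r < i → i + j ≤ k → j ≤ r
  rest≤r {i} {j} r<i i+j≤k =
    +-cancelˡ-≤ r j r (≤-pred (≤-trans (+-monoˡ-≤ j r<i) (≤-trans i+j≤k (n≤1+⌊n/2⌋+⌊n/2⌋ k))))

  survives : ∀ {i j y} → Walk≤ (Edge F) i x y → Walk≤ (Edge F) j y (neg x) → i + j ≤ suc k →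
             y ⇝[ H ] neg x
  survives pre stay _ = ε
  survives {i} {suc j} {y} pre (step {y = y′} e w) bound =
    Edge-filter (satClause? a) e (trans (Edge-clause-value a e) edge-satisfied)
      ◅ survives (pre ▷ e) w (s≤s i+j≤k)
    where
    i+j≤k : i + j ≤ k
    i+j≤k = ≤-pred (subst (_≤ suc k) (+-suc i j) bound)
    edge-satisfied : val a (neg y) ∨ val a y′ ≡ true
    edge-satisfied with i ≤? r
    ... | yes i≤r = ∨-trueˡ (near-true (Walk≤-reverse neg Edge-contrapose (Walk≤-weaken i≤r pre)))
    ... | no i≰r  = ∨-trueʳ (near-true (Walk≤-weaken (rest≤r (≰⇒> i≰r) i+j≤k) w))

  spine : InSpine F x
  spine = H , filter-⊆ (satClause? a) F , (a , all-filter (satClause? a) F) ,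
          ⇝neg⇒¬SatisfiableWith (survives {0} stay shortest ≤-refl)

⇝⇒spine : ∀ {n} {F : Formula n} {x} → x ⇝[ F ] neg x → InSpine F x
⇝⇒spine {F = F} {x} p
  with least (λ m → Walk≤-Edge-dec F m x (neg x)) Walk≤-weaken (proj₂ (Star⇒Walk≤ p))
... | zero  , w , _       = contradiction (Walk≤-zero w) l≢neg-l
... | suc k , w , minimal = Shortest.spine w minimal

lemma2p3 : (n : ℕ) (F : Formula n) (x : Literal n) →
    InSpine F x ⇔ (x ⇝[ F ] neg x)
lemma2p3 n F x = mk⇔ spine⇒⇝ ⇝⇒spine
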